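{- Let $P,Q\in\mathbf{F}_2[x]$ be nonzero polynomials, each even or odd, and let $\varepsilon=0$ if one of them is even, $\varepsilon=1$ otherwise. Write $P=x^{d_1}+\dots+x^{d_r}$ with $d_1\succ\dots\succ d_r$ and $Q=x^{e_1}+\dots+x^{e_s}$ with $e_1\succ\dots\succ e_s$, and let $w$ be the dominant exponent of $PQ$. Let $w'$ be the unique integer $\ge0$ with $w'\equiv d_1+e_1\pmod 2$ and code $[n_3(d_1)+n_3(e_1)+\varepsilon,\ n_5(d_1)+n_5(e_1)]$. Then: (i) $w\preccurlyeq w'$; (ii) if $\mathcal{S}(d_1)\cap\mathcal{S}(e_1)\ne\emptyset$, or if $\varepsilon=1$ and one of $d_1,e_1$ is congruent to $3$ modulo $4$, then $w\prec w'$; (iii) if $\mathcal{S}(d_1)\cap\mathcal{S}(e_1)=\emptyset$ and, in case $\varepsilon=1$, $d_1\equiv e_1\equiv1\pmod 4$, then the dominant monomial of $PQ$ is the product $x^{d_1}x^{e_1}$ of the dominant monomials of $P$ and $Q$, and $w=w'=d_1+e_1$.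
   Context: A polynomial in $\mathbf{F}_2[x]$ is even if it is zero or all its exponents are even; odd if nonzero with all exponents odd. For an integer $k\ge0$ with binary expansion $k=\sum_{i\ge0}\beta_i2^i$: the support is $\mathcal{S}(k)=\{2^i:i\ge1,\beta_i\ne0\}$; $n_3(k)=\sum_{i\text{ odd}}\beta_i2^{(i-1)/2}$, $n_5(k)=\sum_{i\ge2\text{ even}}\beta_i2^{(i-2)/2}$, $h(k)=n_3(k)+n_5(k)$. The code of $k$ is $[n_3(k),n_5(k)]$; $k\mapsto$ code is a bijection from odd (resp. even) integers $\ge0$ onto $\mathbf{N}^2$. For $k,\ell$ of the same parity, $k\prec\ell$ means $h(k)<h(\ell)$, or $h(k)=h(\ell)$ and $n_5(k)<n_5(\ell)$; $k\preccurlyeq\ell$ means $k\prec\ell$ or $k=\ell$ (a total order). The dominant exponent of a nonzero even or odd polynomial is its largest exponent for $\prec$, its dominant monomial the corresponding monomial. -}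

module Defs where

open import Data.Bool using (Bool; true; false; _xor_; if_then_else_)
open import Data.List using (List; []; _∷_; map; upTo)
open import Data.Nat.ListAction using (sum)
open import Data.Nat using (ℕ; zero; suc; _+_; _*_; _^_; _<_; _≤_; ⌊_/2⌋; _%_)
open import Data.Product using (_×_; ∃; Σ)
open import Data.Sum using (_⊎_)
open import Relation.Binary.PropositionalEquality using (_≡_)

-- Polynomials over F₂ : coefficient lists (index = exponent),
-- trailing zeros allowed.  coeff P k = coefficient of x^k.

Poly : Set
Poly = List Bool

coeff : Poly → ℕ → Bool
coeff []       _       = false
coeff (a ∷ _)  zero    = a
coeff (_ ∷ P)  (suc k) = coeff P k

_+ₚ_ : Poly → Poly → Poly
[]      +ₚ Q       = Q
(a ∷ P) +ₚ []      = a ∷ P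
(a ∷ P) +ₚ (b ∷ Q) = (a xor b) ∷ (P +ₚ Q)

_*ₚ_ : Poly → Poly → Poly
[]      *ₚ Q = []
(a ∷ P) *ₚ Q = (if a then Q else []) +ₚ (false ∷ (P *ₚ Q))

Exp : Poly → ℕ → Set
Exp P k = coeff P k ≡ true

Nonzero : Poly → Set
Nonzero P = ∃ λ k → Exp P k

EvenN : ℕ → Set
EvenN k = k % 2 ≡ 0

OddN : ℕ → Set
OddN k = k % 2 ≡ 1

IsEvenPoly : Poly → Set
IsEvenPoly P = ∀ k → Exp P k → EvenN k

IsOddPoly : Poly → Set
IsOddPoly P = Nonzero P × (∀ k → Exp P k → OddN k)

shift : ℕ → ℕ → ℕ
shift zero    k = k
shift (suc i) k = shift i ⌊ k /2⌋

bit : ℕ → ℕ → ℕ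
bit i k = shift i k % 2

-- i ranges over 0 … k, which covers all nonzero digits of k (2^i > k for i > k)
-- n₃(k) = Σ_{i odd} β_i 2^{(i-1)/2}
n3 : ℕ → ℕ
n3 k = sum (map (λ j → bit (suc (2 * j)) k * 2 ^ j) (upTo (suc k)))

n5 : ℕ → ℕ
n5 k = sum (map (λ j → bit (2 + 2 * j) k * 2 ^ j) (upTo (suc k)))

h : ℕ → ℕ
h k = n3 k + n5 k

InSupport : ℕ → ℕ → Set
InSupport k m = ∃ λ i → 1 ≤ i × m ≡ 2 ^ i × bit i k ≡ 1

SupportsMeet : ℕ → ℕ → Set
SupportsMeet k l = ∃ λ m → InSupport k m × InSupport l m

_≺_ : ℕ → ℕ → Set
k ≺ l = h k < h l ⊎ (h k ≡ h l × n5 k < n5 l)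

_≼_ : ℕ → ℕ → Set
k ≼ l = k ≺ l ⊎ k ≡ l

DominantExp : Poly → ℕ → Set
DominantExp P d = Exp P d × (∀ k → Exp P k → k ≼ d)

{-# OPTIONS --safe #-}
module Submission where

-- Only the digits β₁, β₂, … of k enter rank k = (h k , n5 k), and digit βᵢ (i ≥ 1) contributes
-- wᵢ = (2^⌊(i-1)/2⌋ , [i even] 2^((i-2)/2)).  A carry out of position i trades 2·wᵢ for wᵢ₊₁,
-- and wᵢ₊₁ < 2·wᵢ lexicographically (it is (1,1) vs (2,0), or (2,0) vs (2,2), up to scaling).
-- Hence rank (d + e) ≤ rank d + rank e + (ε , 0), with equality exactly when adding
-- ⌊d/2⌋ + ⌊e/2⌋ + ε produces no carry; ε is the carry out of position 0, and the carry
-- conditions are the support and mod-4 conditions of the statement.  Since the lexicographic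
-- order is compatible with addition, rank (d + e) for exponents d of P and e of Q is bounded by
-- the value at (d₁ , e₁), strictly unless (d , e) = (d₁ , e₁).  The exponents of PQ are among
-- these sums, and when there is no carry d₁ + e₁ arises from a single pair, so it survives
-- in PQ and is its dominant exponent.

open import Defs
open import Data.Bool using (Bool; true; false; not; _∧_; _xor_; if_then_else_)
open import Data.Bool.Properties using (xor-identityʳ)
open import Data.Empty using (⊥; ⊥-elim)
open import Data.List using ([]; _∷_; map; upTo)
open import Data.List.Properties using (map-cong; map-upTo; map-applyUpTo)
open import Data.Nat
open import Data.Nat.DivMod using ([m+kn]%n≡m%n; m<n⇒m%n≡m; m%n<n; %-distribˡ-+)
open import Data.Nat.ListAction using (sum)
open import Data.Nat.Properties
open import Data.Nat.Tactic.RingSolver using (solve-∀)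
open import Data.Product using (∃; _×_; _,_; proj₁; proj₂)
open import Data.Product.Properties using (≡-dec)
open import Data.Product.Relation.Binary.Lex.Strict using (×-Lex; ×-transitive)
open import Data.Sum using (_⊎_; inj₁; inj₂; [_,_])
open import Function using (_∘_)
open import Function.Bundles using (_⇔_; mk⇔; Equivalence)
open import Level using (0ℓ)
open import Relation.Binary.Core using (Rel)
open import Relation.Binary.Definitions using (Transitive; tri<; tri≈; tri>)
import Relation.Binary.Construct.StrictToNonStrict as StrictToNonStrict
open import Relation.Binary.PropositionalEquality
  using (_≡_; _≢_; refl; sym; trans; cong; cong₂; subst; subst₂; resp₂; isEquivalence; module ≡-Reasoning)
open import Relation.Nullary using (¬_; yes; no)

-- Binary digits

⌊_/4⌋ : ℕ → ℕ
⌊ m /4⌋ = ⌊ ⌊ m /2⌋ /2⌋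

m%2≤1 : ∀ m → m % 2 ≤ 1
m%2≤1 m = ≤-pred (m%n<n m 2)

m≡m%2+2*⌊m/2⌋ : ∀ m → m ≡ m % 2 + 2 * ⌊ m /2⌋
m≡m%2+2*⌊m/2⌋ 0             = refl
m≡m%2+2*⌊m/2⌋ 1             = refl
m≡m%2+2*⌊m/2⌋ (suc (suc m)) = trans (cong (2 +_) (m≡m%2+2*⌊m/2⌋ m)) (shift-two (m % 2) ⌊ m /2⌋)
  where
  shift-two : ∀ b n → 2 + (b + 2 * n) ≡ b + 2 * suc n
  shift-two = solve-∀

m≡m%2+2*[⌊m/2⌋%2+2*⌊m/4⌋] : ∀ m → m ≡ m % 2 + 2 * (⌊ m /2⌋ % 2 + 2 * ⌊ m /4⌋)
m≡m%2+2*[⌊m/2⌋%2+2*⌊m/4⌋] m =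
  trans (m≡m%2+2*⌊m/2⌋ m) (cong (λ t → m % 2 + 2 * t) (m≡m%2+2*⌊m/2⌋ ⌊ m /2⌋))

[b+2n]%2≡b : ∀ {b} n → b ≤ 1 → (b + 2 * n) % 2 ≡ b
[b+2n]%2≡b {b} n b≤1 = trans (cong (λ t → (b + t) % 2) (*-comm 2 n))
  (trans ([m+kn]%n≡m%n b n 2) (m<n⇒m%n≡m (s≤s b≤1)))

⌊b+2n/2⌋≡n : ∀ {b} n → b ≤ 1 → ⌊ b + 2 * n /2⌋ ≡ n
⌊b+2n/2⌋≡n zero    z≤n       = refl
⌊b+2n/2⌋≡n zero    (s≤s z≤n) = refl
⌊b+2n/2⌋≡n {b} (suc n) b≤1 = trans (cong ⌊_/2⌋ (shift-two b n)) (cong suc (⌊b+2n/2⌋≡n n b≤1))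
  where
  shift-two : ∀ b n → b + 2 * suc n ≡ 2 + (b + 2 * n)
  shift-two = solve-∀

⌊b/2⌋≡0 : ∀ {b} → b ≤ 1 → ⌊ b /2⌋ ≡ 0
⌊b/2⌋≡0 z≤n       = refl
⌊b/2⌋≡0 (s≤s z≤n) = refl

digits-injective : ∀ {b b′ n n′} → b ≤ 1 → b′ ≤ 1 → b + 2 * n ≡ b′ + 2 * n′ → b ≡ b′ × n ≡ n′
digits-injective {n = n} {n′} b≤1 b′≤1 eq =
  trans (sym ([b+2n]%2≡b n b≤1)) (trans (cong (_% 2) eq) ([b+2n]%2≡b n′ b′≤1)) ,
  trans (sym (⌊b+2n/2⌋≡n n b≤1)) (trans (cong ⌊_/2⌋ eq) (⌊b+2n/2⌋≡n n′ b′≤1))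

m≤1+n⇒⌊m/2⌋≤n : ∀ {m n} → m ≤ suc n → ⌊ m /2⌋ ≤ n
m≤1+n⇒⌊m/2⌋≤n {n = n} m≤1+n = ≤-trans (⌊n/2⌋-mono m≤1+n) (≤-pred (⌊n/2⌋<n n))

m≤1+n⇒⌊m/4⌋≤n : ∀ {m n} → m ≤ suc n → ⌊ m /4⌋ ≤ n
m≤1+n⇒⌊m/4⌋≤n m≤1+n = ≤-trans (⌊n/2⌋≤n _) (m≤1+n⇒⌊m/2⌋≤n m≤1+n)

m%4≡m%2+2*[⌊m/2⌋%2] : ∀ m → m % 4 ≡ m % 2 + 2 * (⌊ m /2⌋ % 2)
m%4≡m%2+2*[⌊m/2⌋%2] m = begin
  m % 4
    ≡⟨ cong (_% 4) (trans (m≡m%2+2*[⌊m/2⌋%2+2*⌊m/4⌋] m) (regroup (m % 2) (⌊ m /2⌋ % 2) ⌊ m /4⌋)) ⟩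
  (m % 2 + 2 * (⌊ m /2⌋ % 2) + ⌊ m /4⌋ * 4) % 4
    ≡⟨ [m+kn]%n≡m%n (m % 2 + 2 * (⌊ m /2⌋ % 2)) ⌊ m /4⌋ 4 ⟩
  (m % 2 + 2 * (⌊ m /2⌋ % 2)) % 4
    ≡⟨ m<n⇒m%n≡m (s≤s (+-mono-≤ (m%2≤1 m) (*-monoʳ-≤ 2 (m%2≤1 ⌊ m /2⌋)))) ⟩
  m % 2 + 2 * (⌊ m /2⌋ % 2) ∎
  where
  open ≡-Reasoning
  regroup : ∀ a b q → a + 2 * (b + 2 * q) ≡ a + 2 * b + q * 4
  regroup = solve-∀

⌊m/2⌋%2≡⌊m%4/2⌋ : ∀ m → ⌊ m /2⌋ % 2 ≡ ⌊ m % 4 /2⌋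
⌊m/2⌋%2≡⌊m%4/2⌋ m =
  trans (sym (⌊b+2n/2⌋≡n (⌊ m /2⌋ % 2) (m%2≤1 m))) (cong ⌊_/2⌋ (sym (m%4≡m%2+2*[⌊m/2⌋%2] m)))

bit-0 : ∀ i → bit i 0 ≡ 0
bit-0 zero    = refl
bit-0 (suc i) = bit-0 i

2^-injective : ∀ {i j} → 2 ^ i ≡ 2 ^ j → i ≡ j
2^-injective {i} {j} eq with <-cmp i j
... | tri< i<j _ _ = ⊥-elim (<-irrefl eq (^-monoʳ-< 2 (n<1+n 1) i<j))
... | tri≈ _ i≡j _ = i≡j
... | tri> _ _ j<i = ⊥-elim (<-irrefl (sym eq) (^-monoʳ-< 2 (n<1+n 1) j<i))

-- Even-position digits

sum-map-*ˡ : ∀ {A : Set} c (f : A → ℕ) xs → sum (map (λ x → c * f x) xs) ≡ c * sum (map f xs)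
sum-map-*ˡ c f []       = sym (*-zeroʳ c)
sum-map-*ˡ c f (x ∷ xs) = trans (cong (c * f x +_) (sum-map-*ˡ c f xs)) (sym (*-distribˡ-+ c (f x) _))

sum-upTo-suc : ∀ f n → sum (map f (upTo (suc n))) ≡ f 0 + sum (map (f ∘ suc) (upTo n))
sum-upTo-suc f n = cong (λ xs → f 0 + sum xs) (trans (map-applyUpTo suc f n) (sym (map-upTo (f ∘ suc) n)))

evenDigits : ℕ → ℕ → ℕ
evenDigits zero    m = 0
evenDigits (suc n) m = m % 2 + 2 * evenDigits n ⌊ m /4⌋

evenDigits-0 : ∀ n → evenDigits n 0 ≡ 0
evenDigits-0 zero    = refl
evenDigits-0 (suc n) = cong (2 *_) (evenDigits-0 n)

⌊1+n/4⌋<1+n : ∀ n → ⌊ suc n /4⌋ < suc n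
⌊1+n/4⌋<1+n n = ≤-<-trans (⌊n/2⌋≤n ⌊ suc n /2⌋) (⌊n/2⌋<n n)

evenDigits-stable : ∀ {n n′ m} → m < n → m < n′ → evenDigits n m ≡ evenDigits n′ m
evenDigits-stable {suc n} {suc n′} {zero}  _ _ = trans (evenDigits-0 (suc n)) (sym (evenDigits-0 (suc n′)))
evenDigits-stable {suc n} {suc n′} {suc m} (s≤s m<n) (s≤s m<n′) =
  cong (λ t → suc m % 2 + 2 * t)
    (evenDigits-stable (<-≤-trans (⌊1+n/4⌋<1+n m) m<n) (<-≤-trans (⌊1+n/4⌋<1+n m) m<n′))

sum-evenBits≡evenDigits : ∀ n m → sum (map (λ j → bit (2 * j) m * 2 ^ j) (upTo n)) ≡ evenDigits n m
sum-evenBits≡evenDigits zero    m = refl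
sum-evenBits≡evenDigits (suc n) m = begin
  sum (map (λ j → bit (2 * j) m * 2 ^ j) (upTo (suc n)))
    ≡⟨ sum-upTo-suc (λ j → bit (2 * j) m * 2 ^ j) n ⟩
  m % 2 * 1 + sum (map (λ j → bit (2 * suc j) m * 2 ^ suc j) (upTo n))
    ≡⟨ cong₂ _+_ (*-identityʳ (m % 2)) (cong sum (map-cong next-digit (upTo n))) ⟩
  m % 2 + sum (map (λ j → 2 * (bit (2 * j) ⌊ m /4⌋ * 2 ^ j)) (upTo n))
    ≡⟨ cong (m % 2 +_) (sum-map-*ˡ 2 (λ j → bit (2 * j) ⌊ m /4⌋ * 2 ^ j) (upTo n)) ⟩
  m % 2 + 2 * sum (map (λ j → bit (2 * j) ⌊ m /4⌋ * 2 ^ j) (upTo n))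
    ≡⟨ cong (λ t → m % 2 + 2 * t) (sum-evenBits≡evenDigits n ⌊ m /4⌋) ⟩
  evenDigits (suc n) m ∎
  where
  open ≡-Reasoning
  x*[2*y]≡2*[x*y] : ∀ x y → x * (2 * y) ≡ 2 * (x * y)
  x*[2*y]≡2*[x*y] = solve-∀
  next-digit : ∀ j → bit (2 * suc j) m * 2 ^ suc j ≡ 2 * (bit (2 * j) ⌊ m /4⌋ * 2 ^ j)
  next-digit j = trans (cong (λ i → bit i m * 2 ^ suc j) (*-suc 2 j))
                       (x*[2*y]≡2*[x*y] (bit (2 * j) ⌊ m /4⌋) (2 ^ j))

-- m + 1 base-4 digits are more than m has, so evens m packs all even-position digits of m.
evens : ℕ → ℕ
evens m = evenDigits (suc m) m

evens-digits : ∀ m → evens m ≡ m % 2 + 2 * evens ⌊ m /4⌋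
evens-digits zero    = refl
evens-digits (suc m) = cong (λ t → suc m % 2 + 2 * t) (evenDigits-stable (⌊1+n/4⌋<1+n m) ≤-refl)

sum-evenBits≡evens : ∀ {n} m → m < n → sum (map (λ j → bit (2 * j) m * 2 ^ j) (upTo n)) ≡ evens m
sum-evenBits≡evens {n} m m<n = trans (sum-evenBits≡evenDigits n m) (evenDigits-stable m<n ≤-refl)

n3≡evens : ∀ k → n3 k ≡ evens ⌊ k /2⌋
n3≡evens k = sum-evenBits≡evens ⌊ k /2⌋ (s≤s (⌊n/2⌋≤n k))

n5≡evens : ∀ k → n5 k ≡ evens ⌊ k /4⌋
n5≡evens k = sum-evenBits≡evens ⌊ k /4⌋ (s≤s (≤-trans (⌊n/2⌋≤n ⌊ k /2⌋) (⌊n/2⌋≤n k)))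

evens-injective : ∀ n {m m′} → m ≤ n → m′ ≤ n →
  evens m ≡ evens m′ → evens ⌊ m /2⌋ ≡ evens ⌊ m′ /2⌋ → m ≡ m′
evens-injective zero    z≤n z≤n _ _ = refl
evens-injective (suc n) {m} {m′} m≤1+n m′≤1+n eq eq½ = begin
  m
    ≡⟨ m≡m%2+2*[⌊m/2⌋%2+2*⌊m/4⌋] m ⟩
  m % 2 + 2 * (⌊ m /2⌋ % 2 + 2 * ⌊ m /4⌋)
    ≡⟨ cong₂ (λ b t → b + 2 * t) (proj₁ digit₀) (cong₂ (λ b q → b + 2 * q) (proj₁ digit₁) quarter≡) ⟩
  m′ % 2 + 2 * (⌊ m′ /2⌋ % 2 + 2 * ⌊ m′ /4⌋)
    ≡⟨ sym (m≡m%2+2*[⌊m/2⌋%2+2*⌊m/4⌋] m′) ⟩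
  m′ ∎
  where
  open ≡-Reasoning
  digit₀ : m % 2 ≡ m′ % 2 × evens ⌊ m /4⌋ ≡ evens ⌊ m′ /4⌋
  digit₀ = digits-injective (m%2≤1 m) (m%2≤1 m′) (trans (sym (evens-digits m)) (trans eq (evens-digits m′)))
  digit₁ : ⌊ m /2⌋ % 2 ≡ ⌊ m′ /2⌋ % 2 × evens ⌊ ⌊ m /4⌋ /2⌋ ≡ evens ⌊ ⌊ m′ /4⌋ /2⌋
  digit₁ = digits-injective (m%2≤1 ⌊ m /2⌋) (m%2≤1 ⌊ m′ /2⌋)
             (trans (sym (evens-digits ⌊ m /2⌋)) (trans eq½ (evens-digits ⌊ m′ /2⌋)))
  quarter≡ : ⌊ m /4⌋ ≡ ⌊ m′ /4⌋
  quarter≡ = evens-injective n (m≤1+n⇒⌊m/4⌋≤n m≤1+n) (m≤1+n⇒⌊m/4⌋≤n m′≤1+n)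
               (proj₂ digit₀) (proj₂ digit₁)

-- The lexicographic order on ℕ × ℕ

infixl 6 _⊕_
infix  4 _<ₗₑₓ_ _≤ₗₑₓ_

_⊕_ : ℕ × ℕ → ℕ × ℕ → ℕ × ℕ
(a , b) ⊕ (c , d) = a + c , b + d

⊕-comm : ∀ x y → x ⊕ y ≡ y ⊕ x
⊕-comm (a , b) (c , d) = cong₂ _,_ (+-comm a c) (+-comm b d)

_<ₗₑₓ_ : Rel (ℕ × ℕ) 0ℓ
_<ₗₑₓ_ = ×-Lex _≡_ _<_ _<_

_≤ₗₑₓ_ : Rel (ℕ × ℕ) 0ℓ
_≤ₗₑₓ_ = StrictToNonStrict._≤_ _≡_ _<ₗₑₓ_

<ₗₑₓ-irrefl : ∀ {x} → ¬ x <ₗₑₓ x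
<ₗₑₓ-irrefl (inj₁ a<a)       = <-irrefl refl a<a
<ₗₑₓ-irrefl (inj₂ (_ , b<b)) = <-irrefl refl b<b

<ₗₑₓ-trans : Transitive _<ₗₑₓ_
<ₗₑₓ-trans = ×-transitive {_≈₁_ = _≡_} {_<₁_ = _<_} {_<₂_ = _<_} isEquivalence (resp₂ _<_) <-trans <-trans

<-≤ₗₑₓ-trans : ∀ {x y z} → x <ₗₑₓ y → y ≤ₗₑₓ z → x <ₗₑₓ z
<-≤ₗₑₓ-trans = StrictToNonStrict.<-≤-trans _≡_ _<ₗₑₓ_ <ₗₑₓ-trans (resp₂ _<ₗₑₓ_ .proj₁)

≤ₗₑₓ⇒proj₁≤ : ∀ {x y} → x ≤ₗₑₓ y → proj₁ x ≤ proj₁ y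
≤ₗₑₓ⇒proj₁≤ (inj₁ (inj₁ a<c))       = <⇒≤ a<c
≤ₗₑₓ⇒proj₁≤ (inj₁ (inj₂ (a≡c , _))) = ≤-reflexive a≡c
≤ₗₑₓ⇒proj₁≤ (inj₂ refl)             = ≤-refl

⊕-mono-<-≤ : ∀ {x y u v} → x <ₗₑₓ y → u ≤ₗₑₓ v → x ⊕ u <ₗₑₓ y ⊕ v
⊕-mono-<-≤ (inj₁ a<c)          u≤v                          = inj₁ (+-mono-<-≤ a<c (≤ₗₑₓ⇒proj₁≤ u≤v))
⊕-mono-<-≤ (inj₂ (refl , b<d)) (inj₁ (inj₁ a′<c′))          = inj₁ (+-monoʳ-< _ a′<c′)
⊕-mono-<-≤ (inj₂ (refl , b<d)) (inj₁ (inj₂ (refl , b′<d′))) = inj₂ (refl , +-mono-< b<d b′<d′)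
⊕-mono-<-≤ (inj₂ (refl , b<d)) (inj₂ refl)                  = inj₂ (refl , +-monoˡ-< _ b<d)

⊕-mono-≤-< : ∀ {x y u v} → x ≤ₗₑₓ y → u <ₗₑₓ v → x ⊕ u <ₗₑₓ y ⊕ v
⊕-mono-≤-< {x} {y} {u} {v} x≤y u<v = subst₂ _<ₗₑₓ_ (⊕-comm u x) (⊕-comm v y) (⊕-mono-<-≤ u<v x≤y)

StrictIff : Set → ℕ × ℕ → ℕ × ℕ → Set
StrictIff P x y = (P × x <ₗₑₓ y) ⊎ (¬ P × x ≡ y)

module _ {P : Set} {x y : ℕ × ℕ} where

  StrictIff⇒≤ : StrictIff P x y → x ≤ₗₑₓ y
  StrictIff⇒≤ (inj₁ (_ , x<y)) = inj₁ x<y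
  StrictIff⇒≤ (inj₂ (_ , x≡y)) = inj₂ x≡y

  StrictIff⇒< : StrictIff P x y → P → x <ₗₑₓ y
  StrictIff⇒< (inj₁ (_ , x<y)) _ = x<y
  StrictIff⇒< (inj₂ (¬p , _))  p = ⊥-elim (¬p p)

  StrictIff⇒≡ : StrictIff P x y → ¬ P → x ≡ y
  StrictIff⇒≡ (inj₁ (p , _))   ¬p = ⊥-elim (¬p p)
  StrictIff⇒≡ (inj₂ (_ , x≡y)) _  = x≡y

  StrictIff-cong : ∀ {Q} → P ⇔ Q → StrictIff P x y → StrictIff Q x y
  StrictIff-cong P⇔Q (inj₁ (p , x<y))  = inj₁ (Equivalence.to P⇔Q p , x<y)
  StrictIff-cong P⇔Q (inj₂ (¬p , x≡y)) = inj₂ (¬p ∘ Equivalence.from P⇔Q , x≡y)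

StrictIff-trans : ∀ {P Q x y z} → StrictIff P x y → StrictIff Q y z → StrictIff (P ⊎ Q) x z
StrictIff-trans (inj₁ (p , x<y))   y≤z = inj₁ (inj₁ p , <-≤ₗₑₓ-trans x<y (StrictIff⇒≤ y≤z))
StrictIff-trans (inj₂ (_ , refl))  (inj₁ (q , y<z))   = inj₁ (inj₂ q , y<z)
StrictIff-trans (inj₂ (¬p , refl)) (inj₂ (¬q , refl)) = inj₂ ([ ¬p , ¬q ] , refl)

StrictIff-⊕ˡ : ∀ {P x y} u → StrictIff P x y → StrictIff P (u ⊕ x) (u ⊕ y)
StrictIff-⊕ˡ u (inj₁ (p , x<y))  = inj₁ (p , ⊕-mono-≤-< (inj₂ refl) x<y)
StrictIff-⊕ˡ u (inj₂ (¬p , x≡y)) = inj₂ (¬p , cong (u ⊕_) x≡y)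

-- Positional weights and carries

unit : Bool → ℕ → ℕ × ℕ
unit false b = b , 0
unit true  b = b , b

scale : Bool → ℕ × ℕ → ℕ × ℕ
scale false x = x
scale true  x = x ⊕ x

-- weight false m = rank (2 * m) and weight true m = rank (4 * m): the weight of a numeral m whose
-- lowest digit sits at an odd, resp. even, position ≥ 1.
weight : Bool → ℕ → ℕ × ℕ
weight false m = evens m + evens ⌊ m /2⌋ , evens ⌊ m /2⌋
weight true  m = evens m + 2 * evens ⌊ m /2⌋ , evens m

unit-+ : ∀ φ a b → unit φ (a + b) ≡ unit φ a ⊕ unit φ b
unit-+ false a b = refl
unit-+ true  a b = refl

scale-⊕ : ∀ φ x y → scale φ (x ⊕ y) ≡ scale φ x ⊕ scale φ y
scale-⊕ false x       y       = refl
scale-⊕ true  (a , b) (c , d) = cong₂ _,_ (interchange a c) (interchange b d)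
  where
  interchange : ∀ a c → a + c + (a + c) ≡ a + a + (c + c)
  interchange = solve-∀

StrictIff-scale : ∀ φ {P x y} → StrictIff P x y → StrictIff P (scale φ x) (scale φ y)
StrictIff-scale false r                 = r
StrictIff-scale true  (inj₁ (p , x<y))  = inj₁ (p , ⊕-mono-<-≤ x<y (inj₁ x<y))
StrictIff-scale true  (inj₂ (¬p , x≡y)) = inj₂ (¬p , cong (λ z → z ⊕ z) x≡y)

weight-digits : ∀ φ m → weight φ m ≡ unit φ (m % 2) ⊕ scale φ (weight (not φ) ⌊ m /2⌋)
weight-digits false m = cong (_, evens ⌊ m /2⌋)
  (trans (cong (_+ evens ⌊ m /2⌋) (evens-digits m)) (regroup (m % 2) (evens ⌊ m /2⌋) (evens ⌊ m /4⌋)))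
  where
  regroup : ∀ b e f → b + 2 * f + e ≡ b + (e + 2 * f)
  regroup = solve-∀
weight-digits true m = cong₂ _,_
  (trans (cong (_+ 2 * evens ⌊ m /2⌋) (evens-digits m)) (regroup (m % 2) (evens ⌊ m /2⌋) (evens ⌊ m /4⌋)))
  (trans (evens-digits m) (cong (m % 2 +_) (double (evens ⌊ m /4⌋))))
  where
  regroup : ∀ b e f → b + 2 * f + 2 * e ≡ b + (e + f + (e + f))
  regroup = solve-∀
  double : ∀ f → 2 * f ≡ f + f
  double = solve-∀

weight-[b+2m] : ∀ φ {b} m → b ≤ 1 → weight φ (b + 2 * m) ≡ unit φ b ⊕ scale φ (weight (not φ) m)
weight-[b+2m] φ m b≤1 = trans (weight-digits φ _)
  (cong₂ (λ b′ m′ → unit φ b′ ⊕ scale φ (weight (not φ) m′))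
    ([b+2n]%2≡b m b≤1) (⌊b+2n/2⌋≡n m b≤1))

carry-cost : ∀ φ {k} → k ≤ 1 → StrictIff (k ≡ 1) (scale φ (unit (not φ) k)) (unit φ (2 * k))
carry-cost false z≤n       = inj₂ ((λ ()) , refl)
carry-cost true  z≤n       = inj₂ ((λ ()) , refl)
carry-cost false (s≤s z≤n) = inj₁ (refl , inj₁ (n<1+n 1))
carry-cost true  (s≤s z≤n) = inj₁ (refl , inj₂ (refl , z<s))

CommonBit : ℕ → ℕ → Set
CommonBit X Y = ∃ λ i → bit i X ≡ 1 × bit i Y ≡ 1

Carries : ℕ → ℕ → ℕ → Set
Carries X Y c = (c ≡ 1 × (X % 2 ≡ 1 ⊎ Y % 2 ≡ 1)) ⊎ CommonBit X Y

CarryOut : ℕ → ℕ → ℕ → Set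
CarryOut x y c = (x ≡ 1 × y ≡ 1) ⊎ (c ≡ 1 × (x ≡ 1 ⊎ y ≡ 1))

⌊x+y+c/2⌋≡1⇒CarryOut : ∀ {x y c} → x ≤ 1 → y ≤ 1 → c ≤ 1 → ⌊ x + y + c /2⌋ ≡ 1 → CarryOut x y c
⌊x+y+c/2⌋≡1⇒CarryOut z≤n       z≤n       z≤n       ()
⌊x+y+c/2⌋≡1⇒CarryOut z≤n       z≤n       (s≤s z≤n) ()
⌊x+y+c/2⌋≡1⇒CarryOut z≤n       (s≤s z≤n) z≤n       ()
⌊x+y+c/2⌋≡1⇒CarryOut (s≤s z≤n) z≤n       z≤n       ()
⌊x+y+c/2⌋≡1⇒CarryOut z≤n       (s≤s z≤n) (s≤s z≤n) _ = inj₂ (refl , inj₂ refl)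
⌊x+y+c/2⌋≡1⇒CarryOut (s≤s z≤n) z≤n       (s≤s z≤n) _ = inj₂ (refl , inj₁ refl)
⌊x+y+c/2⌋≡1⇒CarryOut (s≤s z≤n) (s≤s z≤n) _         _ = inj₁ (refl , refl)

CarryOut⇒⌊x+y+c/2⌋≡1 : ∀ {x y c} → x ≤ 1 → y ≤ 1 → c ≤ 1 → CarryOut x y c → ⌊ x + y + c /2⌋ ≡ 1
CarryOut⇒⌊x+y+c/2⌋≡1 _         _         z≤n       (inj₁ (refl , refl))      = refl
CarryOut⇒⌊x+y+c/2⌋≡1 _         _         (s≤s z≤n) (inj₁ (refl , refl))      = refl
CarryOut⇒⌊x+y+c/2⌋≡1 _         z≤n       _         (inj₂ (refl , inj₁ refl)) = refl
CarryOut⇒⌊x+y+c/2⌋≡1 _         (s≤s z≤n) _         (inj₂ (refl , inj₁ refl)) = refl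
CarryOut⇒⌊x+y+c/2⌋≡1 z≤n       _         _         (inj₂ (refl , inj₂ refl)) = refl
CarryOut⇒⌊x+y+c/2⌋≡1 (s≤s z≤n) _         _         (inj₂ (refl , inj₂ refl)) = refl

¬Carries-0-0 : ∀ {c} → ¬ Carries 0 0 c
¬Carries-0-0 (inj₁ (_ , inj₁ ()))
¬Carries-0-0 (inj₁ (_ , inj₂ ()))
¬Carries-0-0 (inj₂ (i , b≡1 , _)) = 0≢1+n (trans (sym (bit-0 i)) b≡1)

module AddLowestDigit (X Y c : ℕ) where

  carry : ℕ
  carry = ⌊ X % 2 + Y % 2 + c /2⌋

  low : ℕ
  low = (X % 2 + Y % 2 + c) % 2

  high : ℕ
  high = ⌊ X /2⌋ + ⌊ Y /2⌋ + carry

  X+Y+c≡low+2*high : X + Y + c ≡ low + 2 * high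
  X+Y+c≡low+2*high = begin
    X + Y + c
      ≡⟨ cong₂ (λ u v → u + v + c) (m≡m%2+2*⌊m/2⌋ X) (m≡m%2+2*⌊m/2⌋ Y) ⟩
    (X % 2 + 2 * ⌊ X /2⌋) + (Y % 2 + 2 * ⌊ Y /2⌋) + c
      ≡⟨ regroup (X % 2) (Y % 2) c ⌊ X /2⌋ ⌊ Y /2⌋ ⟩
    (X % 2 + Y % 2 + c) + 2 * (⌊ X /2⌋ + ⌊ Y /2⌋)
      ≡⟨ cong (_+ 2 * (⌊ X /2⌋ + ⌊ Y /2⌋)) (m≡m%2+2*⌊m/2⌋ (X % 2 + Y % 2 + c)) ⟩
    (low + 2 * carry) + 2 * (⌊ X /2⌋ + ⌊ Y /2⌋)
      ≡⟨ carry-in low carry (⌊ X /2⌋ + ⌊ Y /2⌋) ⟩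
    low + 2 * high ∎
    where
    open ≡-Reasoning
    regroup : ∀ x y c X′ Y′ → x + 2 * X′ + (y + 2 * Y′) + c ≡ x + y + c + 2 * (X′ + Y′)
    regroup = solve-∀
    carry-in : ∀ r k S → r + 2 * k + 2 * S ≡ r + 2 * (S + k)
    carry-in = solve-∀

  carry≤1 : c ≤ 1 → carry ≤ 1
  carry≤1 c≤1 = ⌊n/2⌋-mono (+-mono-≤ (+-mono-≤ (m%2≤1 X) (m%2≤1 Y)) c≤1)

  Carries-unfold : c ≤ 1 → (Carries ⌊ X /2⌋ ⌊ Y /2⌋ carry ⊎ carry ≡ 1) ⇔ Carries X Y c
  Carries-unfold c≤1 = mk⇔ from-high-or-low to-high-or-low
    where
    carry-table : CarryOut (X % 2) (Y % 2) c → carry ≡ 1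
    carry-table = CarryOut⇒⌊x+y+c/2⌋≡1 (m%2≤1 X) (m%2≤1 Y) c≤1
    low-carry : carry ≡ 1 → Carries X Y c
    low-carry k≡1 with ⌊x+y+c/2⌋≡1⇒CarryOut (m%2≤1 X) (m%2≤1 Y) c≤1 k≡1
    ... | inj₁ (x≡1 , y≡1) = inj₂ (0 , x≡1 , y≡1)
    ... | inj₂ c≡1∧odd     = inj₁ c≡1∧odd
    from-high-or-low : Carries ⌊ X /2⌋ ⌊ Y /2⌋ carry ⊎ carry ≡ 1 → Carries X Y c
    from-high-or-low (inj₂ k≡1)                = low-carry k≡1
    from-high-or-low (inj₁ (inj₁ (k≡1 , _)))   = low-carry k≡1
    from-high-or-low (inj₁ (inj₂ (i , x , y))) = inj₂ (suc i , x , y)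
    to-high-or-low : Carries X Y c → Carries ⌊ X /2⌋ ⌊ Y /2⌋ carry ⊎ carry ≡ 1
    to-high-or-low (inj₁ c≡1∧odd)            = inj₂ (carry-table (inj₂ c≡1∧odd))
    to-high-or-low (inj₂ (zero , x≡1 , y≡1)) = inj₂ (carry-table (inj₁ (x≡1 , y≡1)))
    to-high-or-low (inj₂ (suc i , x , y))    = inj₁ (inj₂ (i , x , y))

  summands : Bool → ℕ × ℕ
  summands φ = weight (not φ) ⌊ X /2⌋ ⊕ weight (not φ) ⌊ Y /2⌋

  weight-sum : ∀ φ → weight φ (X + Y + c) ≡ unit φ low ⊕ scale φ (weight (not φ) high)
  weight-sum φ = trans (cong (weight φ) X+Y+c≡low+2*high) (weight-[b+2m] φ high (m%2≤1 (X % 2 + Y % 2 + c)))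

  weight-summands : ∀ φ →
    weight φ X ⊕ weight φ Y ⊕ unit φ c ≡ unit φ low ⊕ (scale φ (summands φ) ⊕ unit φ (2 * carry))
  weight-summands φ = begin
    weight φ X ⊕ weight φ Y ⊕ unit φ c
      ≡⟨ cong₂ (λ u v → u ⊕ v ⊕ unit φ c) (weight-digits φ X) (weight-digits φ Y) ⟩
    (unit φ (X % 2) ⊕ scale φ wX) ⊕ (unit φ (Y % 2) ⊕ scale φ wY) ⊕ unit φ c
      ≡⟨ regroup (unit φ (X % 2)) (scale φ wX) (unit φ (Y % 2)) (scale φ wY) (unit φ c) ⟩
    (unit φ (X % 2) ⊕ unit φ (Y % 2) ⊕ unit φ c) ⊕ (scale φ wX ⊕ scale φ wY)
      ≡⟨ cong₂ _⊕_ (sym (trans (unit-+ φ _ c) (cong (_⊕ unit φ c) (unit-+ φ (X % 2) (Y % 2)))))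
                   (sym (scale-⊕ φ wX wY)) ⟩
    unit φ (X % 2 + Y % 2 + c) ⊕ scale φ (summands φ)
      ≡⟨ cong (λ s → unit φ s ⊕ scale φ (summands φ)) (m≡m%2+2*⌊m/2⌋ (X % 2 + Y % 2 + c)) ⟩
    unit φ (low + 2 * carry) ⊕ scale φ (summands φ)
      ≡⟨ cong (_⊕ scale φ (summands φ)) (unit-+ φ low (2 * carry)) ⟩
    unit φ low ⊕ unit φ (2 * carry) ⊕ scale φ (summands φ)
      ≡⟨ rotate (unit φ low) (unit φ (2 * carry)) (scale φ (summands φ)) ⟩
    unit φ low ⊕ (scale φ (summands φ) ⊕ unit φ (2 * carry)) ∎
    where
    open ≡-Reasoning
    wX wY : ℕ × ℕ
    wX = weight (not φ) ⌊ X /2⌋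
    wY = weight (not φ) ⌊ Y /2⌋
    regroup : ∀ a b c d e → (a ⊕ b) ⊕ (c ⊕ d) ⊕ e ≡ (a ⊕ c ⊕ e) ⊕ (b ⊕ d)
    regroup (a , a′) (b , b′) (c , c′) (d , d′) (e , e′) =
      cong₂ _,_ (+-regroup a b c d e) (+-regroup a′ b′ c′ d′ e′)
      where
      +-regroup : ∀ a b c d e → a + b + (c + d) + e ≡ a + c + e + (b + d)
      +-regroup = solve-∀
    rotate : ∀ a b c → a ⊕ b ⊕ c ≡ a ⊕ (c ⊕ b)
    rotate (a , a′) (b , b′) (c , c′) = cong₂ _,_ (+-rotate a b c) (+-rotate a′ b′ c′)
      where
      +-rotate : ∀ a b c → a + b + c ≡ a + (c + b)
      +-rotate = solve-∀

weight-+ : ∀ n φ {X Y c} → X ≤ n → Y ≤ n → c ≤ 1 →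
  StrictIff (Carries X Y c) (weight φ (X + Y + c)) (weight φ X ⊕ weight φ Y ⊕ unit φ c)
weight-+ zero false z≤n z≤n z≤n       = inj₂ (¬Carries-0-0 , refl)
weight-+ zero false z≤n z≤n (s≤s z≤n) = inj₂ (¬Carries-0-0 , refl)
weight-+ zero true  z≤n z≤n z≤n       = inj₂ (¬Carries-0-0 , refl)
weight-+ zero true  z≤n z≤n (s≤s z≤n) = inj₂ (¬Carries-0-0 , refl)
weight-+ (suc n) φ {X} {Y} {c} X≤1+n Y≤1+n c≤1 =
  subst₂ (StrictIff (Carries X Y c)) (sym (weight-sum φ)) (sym (weight-summands φ))
    (StrictIff-cong (Carries-unfold c≤1) (StrictIff-⊕ˡ (unit φ low) (StrictIff-trans
      (subst (StrictIff _ _) (scale-⊕ φ (summands φ) (unit (not φ) carry)) (StrictIff-scale φ high-part))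
      (StrictIff-⊕ˡ (scale φ (summands φ)) (carry-cost φ (carry≤1 c≤1))))))
  where
  open AddLowestDigit X Y c
  high-part : StrictIff (Carries ⌊ X /2⌋ ⌊ Y /2⌋ carry) (weight (not φ) high) (summands φ ⊕ unit (not φ) carry)
  high-part = weight-+ n (not φ) (m≤1+n⇒⌊m/2⌋≤n X≤1+n) (m≤1+n⇒⌊m/2⌋≤n Y≤1+n) (carry≤1 c≤1)

⌊m+n/2⌋≡⌊m/2⌋+⌊n/2⌋+⌊m%2+n%2/2⌋ : ∀ m n → ⌊ m + n /2⌋ ≡ ⌊ m /2⌋ + ⌊ n /2⌋ + ⌊ m % 2 + n % 2 /2⌋
⌊m+n/2⌋≡⌊m/2⌋+⌊n/2⌋+⌊m%2+n%2/2⌋ m n = begin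
  ⌊ m + n /2⌋          ≡⟨ cong ⌊_/2⌋ (trans (sym (+-identityʳ (m + n))) X+Y+c≡low+2*high) ⟩
  ⌊ low + 2 * high /2⌋ ≡⟨ ⌊b+2n/2⌋≡n high (m%2≤1 (m % 2 + n % 2 + 0)) ⟩
  high                 ≡⟨ cong (λ t → ⌊ m /2⌋ + ⌊ n /2⌋ + ⌊ t /2⌋) (+-identityʳ (m % 2 + n % 2)) ⟩
  ⌊ m /2⌋ + ⌊ n /2⌋ + ⌊ m % 2 + n % 2 /2⌋ ∎
  where
  open ≡-Reasoning
  open AddLowestDigit m n 0

-- Ranks

-- k ≺ l unfolds to rank k <ₗₑₓ rank l, so proofs of the two are used interchangeably.
rank : ℕ → ℕ × ℕ
rank k = h k , n5 k

≼⇒rank≤ : ∀ {k l} → k ≼ l → rank k ≤ₗₑₓ rank l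
≼⇒rank≤ (inj₁ k≺l)  = inj₁ k≺l
≼⇒rank≤ (inj₂ refl) = inj₂ refl

rank≡weight : ∀ k → rank k ≡ weight false ⌊ k /2⌋
rank≡weight k = cong₂ _,_ (cong₂ _+_ (n3≡evens k) (n5≡evens k)) (n5≡evens k)

rank-of-code : ∀ {w d e ε} → n3 w ≡ n3 d + n3 e + ε → n5 w ≡ n5 d + n5 e →
  rank w ≡ rank d ⊕ rank e ⊕ (ε , 0)
rank-of-code {w} {d} {e} {ε} n3-w n5-w = cong₂ _,_
  (trans (cong₂ _+_ n3-w n5-w) (regroup (n3 d) (n3 e) (n5 d) (n5 e) ε))
  (trans n5-w (sym (+-identityʳ (n5 d + n5 e))))
  where
  regroup : ∀ a b c d ε → a + b + ε + (c + d) ≡ a + c + (b + d) + ε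
  regroup = solve-∀

rank-+ : ∀ d e → let κ = ⌊ d % 2 + e % 2 /2⌋ in
  StrictIff (Carries ⌊ d /2⌋ ⌊ e /2⌋ κ) (rank (d + e)) (rank d ⊕ rank e ⊕ (κ , 0))
rank-+ d e = subst₂ (StrictIff _)
  (sym (trans (rank≡weight (d + e)) (cong (weight false) (⌊m+n/2⌋≡⌊m/2⌋+⌊n/2⌋+⌊m%2+n%2/2⌋ d e))))
  (sym (cong₂ (λ u v → u ⊕ v ⊕ (⌊ d % 2 + e % 2 /2⌋ , 0)) (rank≡weight d) (rank≡weight e)))
  (weight-+ (⌊ d /2⌋ + ⌊ e /2⌋) false (m≤m+n _ _) (m≤n+m _ _)
    (⌊n/2⌋-mono (+-mono-≤ (m%2≤1 d) (m%2≤1 e))))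

rank-injective : ∀ {k l} → k % 2 ≡ l % 2 → rank k ≡ rank l → k ≡ l
rank-injective {k} {l} k≡l-mod-2 rank≡ = begin
  k                   ≡⟨ m≡m%2+2*⌊m/2⌋ k ⟩
  k % 2 + 2 * ⌊ k /2⌋ ≡⟨ cong₂ (λ b t → b + 2 * t) k≡l-mod-2 half≡ ⟩
  l % 2 + 2 * ⌊ l /2⌋ ≡⟨ sym (m≡m%2+2*⌊m/2⌋ l) ⟩
  l                   ∎
  where
  open ≡-Reasoning
  n5≡ : n5 k ≡ n5 l
  n5≡ = cong proj₂ rank≡
  n3≡ : n3 k ≡ n3 l
  n3≡ = +-cancelʳ-≡ (n5 k) (n3 k) (n3 l) (trans (cong proj₁ rank≡) (cong (n3 l +_) (sym n5≡)))
  half≡ : ⌊ k /2⌋ ≡ ⌊ l /2⌋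
  half≡ = evens-injective (k + l) (≤-trans (⌊n/2⌋≤n k) (m≤m+n k l)) (≤-trans (⌊n/2⌋≤n l) (m≤n+m l k))
            (trans (sym (n3≡evens k)) (trans n3≡ (n3≡evens l))) (trans (sym (n5≡evens k)) (trans n5≡ (n5≡evens l)))

rank≤⇒≼ : ∀ {k l} → k % 2 ≡ l % 2 → rank k ≤ₗₑₓ rank l → k ≼ l
rank≤⇒≼ _         (inj₁ k≺l)   = inj₁ k≺l
rank≤⇒≼ k≡l-mod-2 (inj₂ rank≡) = inj₂ (rank-injective k≡l-mod-2 rank≡)

rank-⊕-mono : ∀ {d d₁ e e₁} u → d ≼ d₁ → e ≼ e₁ →
  StrictIff ((d , e) ≢ (d₁ , e₁)) (rank d ⊕ rank e ⊕ u) (rank d₁ ⊕ rank e₁ ⊕ u)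
rank-⊕-mono {d} {d₁} {e} {e₁} u (inj₁ d≺d₁) e≼e₁ =
  inj₁ ((λ eq → <ₗₑₓ-irrefl (subst (λ k → rank k <ₗₑₓ rank d₁) (cong proj₁ eq) d≺d₁)) ,
        ⊕-mono-<-≤ {rank d ⊕ rank e} {rank d₁ ⊕ rank e₁} {u} {u}
          (⊕-mono-<-≤ d≺d₁ (≼⇒rank≤ e≼e₁)) (inj₂ refl))
rank-⊕-mono {d} {_} {e} {e₁} u (inj₂ refl) (inj₁ e≺e₁) =
  inj₁ ((λ eq → <ₗₑₓ-irrefl (subst (λ k → rank k <ₗₑₓ rank e₁) (cong proj₂ eq) e≺e₁)) ,
        ⊕-mono-<-≤ {rank d ⊕ rank e} {rank d ⊕ rank e₁} {u} {u}
          (⊕-mono-≤-< {rank d} (inj₂ refl) e≺e₁) (inj₂ refl))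
rank-⊕-mono u (inj₂ refl) (inj₂ refl) = inj₂ ((λ ne → ne refl) , refl)

-- Carries in terms of supports and residues mod 4

SupportsMeet⇒CommonBit : ∀ {d e} → SupportsMeet d e → CommonBit ⌊ d /2⌋ ⌊ e /2⌋
SupportsMeet⇒CommonBit (_ , (suc i , _ , m≡2^i , bit-d) , (j , _ , m≡2^j , bit-e))
  with 2^-injective {suc i} {j} (trans (sym m≡2^i) m≡2^j)
... | refl = i , bit-d , bit-e

CommonBit⇒SupportsMeet : ∀ {d e} → CommonBit ⌊ d /2⌋ ⌊ e /2⌋ → SupportsMeet d e
CommonBit⇒SupportsMeet (i , bit-d , bit-e) =
  2 ^ suc i , (suc i , s≤s z≤n , refl , bit-d) , (suc i , s≤s z≤n , refl , bit-e)

SupportsMeet⊎≡3-mod-4⇒Carries : ∀ {d e c} → SupportsMeet d e ⊎ (c ≡ 1 × (d % 4 ≡ 3 ⊎ e % 4 ≡ 3)) →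
  Carries ⌊ d /2⌋ ⌊ e /2⌋ c
SupportsMeet⊎≡3-mod-4⇒Carries (inj₁ meet) = inj₂ (SupportsMeet⇒CommonBit meet)
SupportsMeet⊎≡3-mod-4⇒Carries {d} (inj₂ (c≡1 , inj₁ d≡3)) =
  inj₁ (c≡1 , inj₁ (trans (⌊m/2⌋%2≡⌊m%4/2⌋ d) (cong ⌊_/2⌋ d≡3)))
SupportsMeet⊎≡3-mod-4⇒Carries {e = e} (inj₂ (c≡1 , inj₂ e≡3)) =
  inj₁ (c≡1 , inj₂ (trans (⌊m/2⌋%2≡⌊m%4/2⌋ e) (cong ⌊_/2⌋ e≡3)))

¬SupportsMeet∧≡1-mod-4⇒¬Carries : ∀ {d e c} → ¬ SupportsMeet d e → (c ≡ 1 → d % 4 ≡ 1 × e % 4 ≡ 1) →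
  ¬ Carries ⌊ d /2⌋ ⌊ e /2⌋ c
¬SupportsMeet∧≡1-mod-4⇒¬Carries ¬meet _ (inj₂ common) = ¬meet (CommonBit⇒SupportsMeet common)
¬SupportsMeet∧≡1-mod-4⇒¬Carries {d} {e} _ ≡1-mod-4 (inj₁ (c≡1 , odd)) with ≡1-mod-4 c≡1
... | d≡1 , e≡1 = [ half-even d d≡1 , half-even e e≡1 ] odd
  where
  half-even : ∀ m → m % 4 ≡ 1 → ⌊ m /2⌋ % 2 ≢ 1
  half-even m m≡1 odd = 0≢1+n (trans (sym (cong ⌊_/2⌋ m≡1)) (trans (sym (⌊m/2⌋%2≡⌊m%4/2⌋ m)) odd))

-- Exponents of products in 𝐅₂[x]

coeff-+ₚ : ∀ A B k → coeff (A +ₚ B) k ≡ coeff A k xor coeff B k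
coeff-+ₚ []      B       k       = refl
coeff-+ₚ (a ∷ A) []      k       = sym (xor-identityʳ (coeff (a ∷ A) k))
coeff-+ₚ (a ∷ A) (b ∷ B) zero    = refl
coeff-+ₚ (a ∷ A) (b ∷ B) (suc k) = coeff-+ₚ A B k

coeff-∷*ₚ : ∀ a P Q k → coeff ((a ∷ P) *ₚ Q) k ≡ (a ∧ coeff Q k) xor coeff (false ∷ (P *ₚ Q)) k
coeff-∷*ₚ a P Q k = trans (coeff-+ₚ (if a then Q else []) _ k) (cong (_xor _) (coeff-if a))
  where
  coeff-if : ∀ a → coeff (if a then Q else []) k ≡ a ∧ coeff Q k
  coeff-if false = refl
  coeff-if true  = refl

xor≡true : ∀ {a b} → a xor b ≡ true → a ≡ true ⊎ b ≡ true
xor≡true {true}  _    = inj₁ refl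
xor≡true {false} b≡tt = inj₂ b≡tt

∧≡false : ∀ {a b} → (a ≡ true → b ≡ true → ⊥) → a ∧ b ≡ false
∧≡false {false}         _ = refl
∧≡false {true}  {false} _ = refl
∧≡false {true}  {true}  f = ⊥-elim (f refl refl)

coeff-false∷ : ∀ R {k} → (∀ {k′} → k ≡ suc k′ → coeff R k′ ≡ false) → coeff (false ∷ R) k ≡ false
coeff-false∷ R {zero}  _    = refl
coeff-false∷ R {suc k} tail = tail refl

Exp-*ₚ⇒sum : ∀ P Q {k} → Exp (P *ₚ Q) k → ∃ λ i → ∃ λ j → i + j ≡ k × Exp P i × Exp Q j
Exp-*ₚ⇒sum (a ∷ P) Q {k} PQk
  with xor≡true {a ∧ coeff Q k} {coeff (false ∷ (P *ₚ Q)) k} (trans (sym (coeff-∷*ₚ a P Q k)) PQk)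
Exp-*ₚ⇒sum (true  ∷ P) Q {k}     _ | inj₁ Qk = 0 , k , refl , refl , Qk
Exp-*ₚ⇒sum (false ∷ P) Q         _ | inj₁ ()
Exp-*ₚ⇒sum (a ∷ P)     Q {zero}  _ | inj₂ ()
Exp-*ₚ⇒sum (a ∷ P)     Q {suc k} _ | inj₂ PQk with Exp-*ₚ⇒sum P Q PQk
... | i , j , i+j≡k , Pi , Qj = suc i , j , cong suc i+j≡k , Pi , Qj

coeff-*ₚ≡false : ∀ P Q {k} → (∀ {i j} → i + j ≡ k → Exp P i → Exp Q j → ⊥) → coeff (P *ₚ Q) k ≡ false
coeff-*ₚ≡false []      Q     _    = refl
coeff-*ₚ≡false (a ∷ P) Q {k} none = trans (coeff-∷*ₚ a P Q k) (cong₂ _xor_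
  (∧≡false (none {0} refl))
  (coeff-false∷ (P *ₚ Q) {k} λ { refl → coeff-*ₚ≡false P Q (λ i+j≡k → none (cong suc i+j≡k)) }))

Exp-*ₚ-unique : ∀ P Q {i j} → Exp P i → Exp Q j →
  (∀ {i′ j′} → i′ + j′ ≡ i + j → Exp P i′ → Exp Q j′ → i′ ≡ i) → Exp (P *ₚ Q) (i + j)
Exp-*ₚ-unique (a ∷ P) Q {zero} {j} refl Qj unique = begin
  coeff ((true ∷ P) *ₚ Q) j                ≡⟨ coeff-∷*ₚ true P Q j ⟩
  coeff Q j xor coeff (false ∷ (P *ₚ Q)) j ≡⟨ cong₂ _xor_ Qj (coeff-false∷ (P *ₚ Q) no-later) ⟩
  true                                     ∎
  where
  open ≡-Reasoning
  no-later : ∀ {k′} → j ≡ suc k′ → coeff (P *ₚ Q) k′ ≡ false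
  no-later refl = coeff-*ₚ≡false P Q (λ i+j≡k Pi Qj′ → 0≢1+n (sym (unique (cong suc i+j≡k) Pi Qj′)))
Exp-*ₚ-unique (a ∷ P) Q {suc i} {j} Pi Qj unique = begin
  coeff ((a ∷ P) *ₚ Q) (suc (i + j))                     ≡⟨ coeff-∷*ₚ a P Q (suc (i + j)) ⟩
  (a ∧ coeff Q (suc (i + j))) xor coeff (P *ₚ Q) (i + j) ≡⟨ cong₂ _xor_ (∧≡false not-first) later ⟩
  true                                                   ∎
  where
  open ≡-Reasoning
  not-first : a ≡ true → Exp Q (suc (i + j)) → ⊥
  not-first a≡true Q′ = 0≢1+n (unique refl a≡true Q′)
  later : Exp (P *ₚ Q) (i + j)
  later = Exp-*ₚ-unique P Q Pi Qj
            (λ i′+j′≡i+j Pi′ Qj′ → suc-injective (unique (cong suc i′+j′≡i+j) Pi′ Qj′))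

Exp-parity : ∀ P → IsEvenPoly P ⊎ IsOddPoly P → ∀ {i j} → Exp P i → Exp P j → i % 2 ≡ j % 2
Exp-parity _ (inj₁ even)      Pi Pj = trans (even _ Pi) (sym (even _ Pj))
Exp-parity _ (inj₂ (_ , odd)) Pi Pj = trans (odd _ Pi) (sym (odd _ Pj))

carry-of-parities : ∀ P Q {ε d e} →
  (ε ≡ 0 × (IsEvenPoly P ⊎ IsEvenPoly Q)) ⊎ (ε ≡ 1 × IsOddPoly P × IsOddPoly Q) →
  Exp P d → Exp Q e → ⌊ d % 2 + e % 2 /2⌋ ≡ ε
carry-of-parities _ _ {d = d} {e} (inj₁ (refl , inj₁ even-P)) Pd Qe rewrite even-P d Pd = ⌊b/2⌋≡0 (m%2≤1 e)
carry-of-parities _ _ {d = d} {e} (inj₁ (refl , inj₂ even-Q)) Pd Qe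
  rewrite even-Q e Qe | +-identityʳ (d % 2) = ⌊b/2⌋≡0 (m%2≤1 d)
carry-of-parities _ _ {d = d} {e} (inj₂ (refl , (_ , odd-P) , (_ , odd-Q))) Pd Qe
  rewrite odd-P d Pd | odd-Q e Qe = refl

-- The dominant exponent of a product

module DominantProduct {P Q : Poly} {ε d₁ e₁ : ℕ}
  (parity-P : IsEvenPoly P ⊎ IsOddPoly P) (parity-Q : IsEvenPoly Q ⊎ IsOddPoly Q)
  (ε-def : (ε ≡ 0 × (IsEvenPoly P ⊎ IsEvenPoly Q)) ⊎ (ε ≡ 1 × IsOddPoly P × IsOddPoly Q))
  (dom-P : DominantExp P d₁) (dom-Q : DominantExp Q e₁) where

  target : ℕ × ℕ
  target = rank d₁ ⊕ rank e₁ ⊕ (ε , 0)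

  rank-sum : ∀ {d e} → Exp P d → Exp Q e →
    StrictIff (Carries ⌊ d /2⌋ ⌊ e /2⌋ ε ⊎ (d , e) ≢ (d₁ , e₁)) (rank (d + e)) target
  rank-sum {d} {e} Pd Qe = StrictIff-trans
    (subst (λ κ → StrictIff (Carries ⌊ d /2⌋ ⌊ e /2⌋ κ) (rank (d + e)) (rank d ⊕ rank e ⊕ (κ , 0)))
      (carry-of-parities P Q ε-def Pd Qe) (rank-+ d e))
    (rank-⊕-mono (ε , 0) (proj₂ dom-P d Pd) (proj₂ dom-Q e Qe))

  sum-parity : ∀ {d e} → Exp P d → Exp Q e → (d + e) % 2 ≡ (d₁ + e₁) % 2
  sum-parity {d} {e} Pd Qe = begin
    (d + e) % 2           ≡⟨ %-distribˡ-+ d e 2 ⟩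
    (d % 2 + e % 2) % 2   ≡⟨ cong₂ (λ a b → (a + b) % 2) (Exp-parity P parity-P Pd (proj₁ dom-P))
                                                          (Exp-parity Q parity-Q Qe (proj₁ dom-Q)) ⟩
    (d₁ % 2 + e₁ % 2) % 2 ≡⟨ sym (%-distribˡ-+ d₁ e₁ 2) ⟩
    (d₁ + e₁) % 2         ∎
    where open ≡-Reasoning

  module _ (¬carries : ¬ Carries ⌊ d₁ /2⌋ ⌊ e₁ /2⌋ ε) where

    rank-top : rank (d₁ + e₁) ≡ target
    rank-top = StrictIff⇒≡ (rank-sum (proj₁ dom-P) (proj₁ dom-Q)) [ ¬carries , (λ ne → ne refl) ]

    Exp-top : Exp (P *ₚ Q) (d₁ + e₁)
    Exp-top = Exp-*ₚ-unique P Q (proj₁ dom-P) (proj₁ dom-Q) unique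
      where
      unique : ∀ {i j} → i + j ≡ d₁ + e₁ → Exp P i → Exp Q j → i ≡ d₁
      unique {i} i+j≡ Pi Qj with i ≟ d₁
      ... | yes i≡d₁ = i≡d₁
      ... | no  i≢d₁ = ⊥-elim (<ₗₑₓ-irrefl (subst (_<ₗₑₓ target) (trans (cong rank i+j≡) rank-top)
                         (StrictIff⇒< (rank-sum Pi Qj) (inj₂ (i≢d₁ ∘ cong proj₁)))))

  module _ {w : ℕ} (dom-PQ : DominantExp (P *ₚ Q) w) where

    dominant-parity : w % 2 ≡ (d₁ + e₁) % 2
    dominant-parity with Exp-*ₚ⇒sum P Q (proj₁ dom-PQ)
    ... | _ , _ , refl , Pd , Qe = sum-parity Pd Qe

    rank-dominant≤ : rank w ≤ₗₑₓ target
    rank-dominant≤ with Exp-*ₚ⇒sum P Q (proj₁ dom-PQ)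
    ... | _ , _ , refl , Pd , Qe = StrictIff⇒≤ (rank-sum Pd Qe)

    rank-dominant< : Carries ⌊ d₁ /2⌋ ⌊ e₁ /2⌋ ε → rank w <ₗₑₓ target
    rank-dominant< carries with Exp-*ₚ⇒sum P Q (proj₁ dom-PQ)
    ... | d , e , refl , Pd , Qe with ≡-dec _≟_ _≟_ (d , e) (d₁ , e₁)
    ...   | yes refl = StrictIff⇒< (rank-sum Pd Qe) (inj₁ carries)
    ...   | no  ne   = StrictIff⇒< (rank-sum Pd Qe) (inj₂ ne)

    dominant≡top : ¬ Carries ⌊ d₁ /2⌋ ⌊ e₁ /2⌋ ε → w ≡ d₁ + e₁
    dominant≡top ¬carries with proj₂ dom-PQ (d₁ + e₁) (Exp-top ¬carries)
    ... | inj₂ top≡w = sym top≡w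
    ... | inj₁ top≺w = ⊥-elim (<ₗₑₓ-irrefl
          (<-≤ₗₑₓ-trans top≺w (subst (rank w ≤ₗₑₓ_) (sym (rank-top ¬carries)) rank-dominant≤)))

mainTheorem17 : (P Q : Poly) → Nonzero P → Nonzero Q
    → (IsEvenPoly P ⊎ IsOddPoly P) → (IsEvenPoly Q ⊎ IsOddPoly Q)
    → (ε : ℕ)
    → ((ε ≡ 0 × (IsEvenPoly P ⊎ IsEvenPoly Q)) ⊎ (ε ≡ 1 × IsOddPoly P × IsOddPoly Q))
    → (d₁ e₁ w w′ : ℕ)
    → DominantExp P d₁ → DominantExp Q e₁ → DominantExp (P *ₚ Q) w
    → w′ % 2 ≡ (d₁ + e₁) % 2
    → n3 w′ ≡ n3 d₁ + n3 e₁ + ε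
    → n5 w′ ≡ n5 d₁ + n5 e₁
    → (w ≼ w′)
      × ((SupportsMeet d₁ e₁ ⊎ (ε ≡ 1 × (d₁ % 4 ≡ 3 ⊎ e₁ % 4 ≡ 3))) → w ≺ w′)
      × (¬ SupportsMeet d₁ e₁ → (ε ≡ 1 → d₁ % 4 ≡ 1 × e₁ % 4 ≡ 1)
          → w ≡ d₁ + e₁ × w′ ≡ d₁ + e₁)
mainTheorem17 P Q _ _ parity-P parity-Q ε ε-def d₁ e₁ w w′ dom-P dom-Q dom-PQ w′-parity n3-w′ n5-w′ =
  rank≤⇒≼ (trans (dominant-parity dom-PQ) (sym w′-parity))
    (subst (rank w ≤ₗₑₓ_) (sym rank-w′) (rank-dominant≤ dom-PQ)) ,
  (λ carry-condition → subst (rank w <ₗₑₓ_) (sym rank-w′)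
     (rank-dominant< dom-PQ (SupportsMeet⊎≡3-mod-4⇒Carries carry-condition))) ,
  λ ¬meet ≡1-mod-4 → let ¬carries = ¬SupportsMeet∧≡1-mod-4⇒¬Carries ¬meet ≡1-mod-4 in
    dominant≡top dom-PQ ¬carries , rank-injective w′-parity (trans rank-w′ (sym (rank-top ¬carries)))
  where
  open DominantProduct {P} {Q} parity-P parity-Q ε-def dom-P dom-Q
  rank-w′ : rank w′ ≡ target
  rank-w′ = rank-of-code {w′} {d₁} {e₁} n3-w′ n5-w′
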